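{- Let $n\geq 4$, and let $P,Q$ be subsets of $[n]$ with $p=|P|\geq 3$, $q=|Q|\geq 3$, $P\cup Q=[n]$ and $P\cap Q=\{n-2\}$. Let $x=x_1\cdots x_p$ be a permutation of $P$ and $y=y_1\cdots y_q$ a permutation of $Q$ such that $x_p=n-2=y_q$ and $x_{p-1}>y_{q-1}$. Then: (1) If $x$ and $y$ are primitive G-words, then $w=(n,\ x_{p-1},\dots,x_2,\ n-2,\ y_2,\dots,y_{q-1},\ n-1)$ is a primitive G-word. (2) If $x$ and $y$ are primitive R-words, then $w=(n,\ y_{q-1},\dots,y_2,\ n-2,\ x_2,\dots,x_{p-1},\ n-1)$ is a primitive R-word. (Commas denote concatenation.)
   Context: For a finite set $P$ of positive integers with $|P|=n$, a permutation $w$ of $P$ is written as a word $w=w_1w_2\cdots w_n$ with $\{w_1,\dots,w_n\}=P$. The reversal of $w$ is $w^*=w_nw_{n-1}\cdots w_1$. A subword of $w$ is a contiguous word $w[i,j]=w_iw_{i+1}\cdots w_j$ with $1\le i\le j\le n$; it is proper if $w[i,j]\neq w$. Let $|P|=n\geq 2$. A permutation $w$ of $P$ is a G-word if (G1) $w_1=\max(P)$ and $w_n=\max(P\setminus\{w_1\})$, and (G2) if $n\geq 4$ then $w_2>w_{n-1}$. It is an R-word if (R1) $w_1=\max(P)$ and $w_n=\max(P\setminus\{w_1\})$, and (R2) if $n\geq 4$ then $w_2<w_{n-1}$. A G-word (resp. R-word) $w$ is primitive if for every proper subword $x$ of $w$ of length at least $4$, neither $x$ nor $x^*$ is a G-word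 (resp. R-word). -}

module Defs where

open import Data.Nat using (ℕ; zero; suc; _∸_; _≤_; _<_; _>_)
open import Data.List using (List; []; _∷_; _++_; [_]; length; reverse; take; drop)
open import Data.List.Membership.Propositional using (_∈_)
open import Data.List.Relation.Unary.Unique.Propositional using (Unique)
open import Data.Product using (Σ; _×_)
open import Relation.Nullary using (¬_)
open import Relation.Binary.PropositionalEquality using (_≡_; _≢_)

-- A word is a list of natural numbers; the underlying set P of a word w
-- is the set of its entries, and w is a permutation of P iff it has no
-- repeated entries (Unique w).
Word : Set
Word = List ℕ

-- 1-indexed letter w_i (default 0 when out of range; only ever used in range
-- under the length hypotheses of the definitions below).
at : Word → ℕ → ℕ
at []       _             = 0
at (a ∷ w)  zero          = 0
at (a ∷ w)  (suc zero)    = a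
at (a ∷ w)  (suc (suc i)) = at w (suc i)

IsMaxOf : ℕ → Word → Set
IsMaxOf m w = m ∈ w × (∀ k → k ∈ w → k ≤ m)

IsMaxOfWithout : ℕ → Word → ℕ → Set
IsMaxOfWithout m w a = m ∈ w × m ≢ a × (∀ k → k ∈ w → k ≢ a → k ≤ m)

Cond1 : Word → Set
Cond1 w = Unique w × 2 ≤ length w
        × IsMaxOf (at w 1) w
        × IsMaxOfWithout (at w (length w)) w (at w 1)

IsGWord : Word → Set
IsGWord w = Cond1 w × (4 ≤ length w → at w 2 > at w (length w ∸ 1))

IsRWord : Word → Set
IsRWord w = Cond1 w × (4 ≤ length w → at w 2 < at w (length w ∸ 1))

Subword : Word → Word → Set
Subword x w = Σ Word λ as → Σ Word λ bs → as ++ x ++ bs ≡ w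

ProperSubword : Word → Word → Set
ProperSubword x w = Subword x w × x ≢ w

IsPrimitiveG : Word → Set
IsPrimitiveG w = IsGWord w ×
  (∀ x → ProperSubword x w → 4 ≤ length x → ¬ IsGWord x × ¬ IsGWord (reverse x))

IsPrimitiveR : Word → Set
IsPrimitiveR w = IsRWord w ×
  (∀ x → ProperSubword x w → 4 ≤ length x → ¬ IsRWord x × ¬ IsRWord (reverse x))

inner : Word → Word
inner w = take (length w ∸ 2) (drop 1 w)

wordG : ℕ → Word → Word → Word
wordG n x y = n ∷ reverse (inner x) ++ (n ∸ 2) ∷ inner y ++ [ n ∸ 1 ]

wordR : ℕ → Word → Word → Word
wordR n x y = n ∷ reverse (inner y) ++ (n ∸ 2) ∷ inner x ++ [ n ∸ 1 ]

-- Write x = x₁ ∷ U ++ [ c ] and y = y₁ ∷ V ++ [ c ] with c = n-2. A word a ∷ m ++ [ b ] without repeated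
-- letters is a G-word (R-word) exactly when every letter of m lies below b < a and the first letter of m
-- is > (<) its last one; in particular a enters only as a letter exceeding b. Hence the glued word
-- n ∷ reverse U ++ c ∷ V ++ [ n-1 ] is a word, and a proper subword s that is a word up to reversal can
-- be pushed into x or y: inside reverse U or V it is (up to reversal) a subword of x or y; with c or n at an
-- end, replacing that end by x₁, y₁ or c gives such a subword of x or y; and c cannot be interior to s,
-- since an end of s would then be a letter of U or V, below c. The one exception, n ∷ reverse U ++ [ c ],
-- would relate the ends of U in both directions. Subwords containing n-1 are mirror images of these.
module Submission where

open import Defs
open import Data.Nat using (ℕ; suc; _+_; _∸_; _≤_; _<_; _>_; s≤s; z≤n)
open import Data.Nat.Properties
  using (≤-refl; ≤-pred; <-trans; <⇒≤; <-irrefl; <-asym; ≤∧≢⇒<; +-comm; m≤m+n; m≤n+m; n<1+n; module ≤-Reasoning)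
open import Data.List using ([]; _∷_; _++_; [_]; _∷ʳ_; length; reverse; take; initLast; _∷ʳ′_)
open import Data.List.Properties
  using (++-assoc; ++-identityʳ; length-++; length-reverse; reverse-++; unfold-reverse; reverse-involutive; ∷-injective; ∷-injectiveʳ; ∷ʳ-injective)
open import Data.List.Membership.Propositional using (_∈_; _∉_)
open import Data.List.Membership.Propositional.Properties using (∈-++⁺ˡ; ∈-++⁺ʳ; ∈-++⁻)
open import Data.List.Relation.Unary.Any using (here; there)
import Data.List.Relation.Unary.Any.Properties as Any
open import Data.List.Relation.Unary.All using ([]; _∷_)
open import Data.List.Relation.Unary.All.Properties using (¬Any⇒All¬; ++⁻; ++⁻ʳ)
open import Data.List.Relation.Unary.Unique.Propositional using (Unique; []; _∷_)
import Data.List.Relation.Unary.Unique.Propositional.Properties as Unique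
open import Data.List.Relation.Binary.Permutation.Propositional using (↭⇒↭ₛ; ↭-sym)
open import Data.List.Relation.Binary.Permutation.Propositional.Properties using (↭-reverse)
open import Data.Product using (Σ; _×_; _,_; proj₁; proj₂)
open import Data.Sum using (_⊎_; inj₁; inj₂)
open import Data.Empty using (⊥-elim)
open import Function using (flip)
open import Relation.Binary.Definitions using (Asymmetric)
open import Relation.Nullary using (¬_)
open import Relation.Binary.PropositionalEquality
  using (_≡_; _≢_; refl; sym; trans; cong; cong₂; subst; subst₂; setoid; module ≡-Reasoning)
open import Data.List.Relation.Binary.Permutation.Setoid.Properties (setoid ℕ) using (Unique-resp-↭)

Prefix : Word → Word → Set
Prefix p w = Σ Word λ r → p ++ r ≡ w

Suffix : Word → Word → Set
Suffix s w = Σ Word λ r → r ++ s ≡ w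

length-∷ʳ : ∀ (xs : Word) x → length (xs ∷ʳ x) ≡ suc (length xs)
length-∷ʳ xs x = trans (length-++ xs) (+-comm (length xs) 1)

reverse-framed : ∀ a (m : Word) b → reverse (a ∷ m ++ [ b ]) ≡ b ∷ reverse m ++ [ a ]
reverse-framed a m b = begin
  reverse (a ∷ m ++ [ b ])       ≡⟨ unfold-reverse a (m ++ [ b ]) ⟩
  reverse (m ++ [ b ]) ++ [ a ]  ≡⟨ cong (_++ [ a ]) (reverse-++ m [ b ]) ⟩
  b ∷ reverse m ++ [ a ]         ∎
  where open ≡-Reasoning

reverse-around : ∀ (xs : Word) c ys → reverse (xs ++ c ∷ ys) ≡ reverse ys ++ c ∷ reverse xs
reverse-around xs c ys = begin
  reverse (xs ++ c ∷ ys)               ≡⟨ reverse-++ xs (c ∷ ys) ⟩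
  reverse (c ∷ ys) ++ reverse xs       ≡⟨ cong (_++ reverse xs) (unfold-reverse c ys) ⟩
  (reverse ys ++ [ c ]) ++ reverse xs  ≡⟨ ++-assoc (reverse ys) [ c ] (reverse xs) ⟩
  reverse ys ++ c ∷ reverse xs         ∎
  where open ≡-Reasoning

∈-framed : ∀ {k a b} (m : Word) → k ∈ a ∷ m ++ [ b ] → k ≡ a ⊎ k ∈ m ⊎ k ≡ b
∈-framed m (here k≡a) = inj₁ k≡a
∈-framed m (there k∈) with ∈-++⁻ m k∈
... | inj₁ k∈m        = inj₂ (inj₁ k∈m)
... | inj₂ (here k≡b) = inj₂ (inj₂ k≡b)

inner-framed : ∀ a (m : Word) b → inner (a ∷ m ++ [ b ]) ≡ m
inner-framed a m b rewrite length-∷ʳ m b = take-length m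
  where
  take-length : ∀ (xs : Word) → take (length xs) (xs ++ [ b ]) ≡ xs
  take-length []       = refl
  take-length (x ∷ xs) = cong (x ∷_) (take-length xs)

length-framed : ∀ a (m : Word) b → length (a ∷ m ++ [ b ]) ≡ suc (suc (length m))
length-framed a m b = cong suc (length-∷ʳ m b)

at-++-∷ : ∀ (xs : Word) d ys → at (xs ++ d ∷ ys) (suc (length xs)) ≡ d
at-++-∷ []       d ys = refl
at-++-∷ (x ∷ xs) d ys = at-++-∷ xs d ys

at-last : ∀ a (m : Word) b → at (a ∷ m ++ [ b ]) (length (a ∷ m ++ [ b ])) ≡ b
at-last a m b rewrite length-∷ʳ m b = at-++-∷ (a ∷ m) b []

at-penultimate : ∀ a (m : Word) d b →
  at (a ∷ (m ++ [ d ]) ++ [ b ]) (length (a ∷ (m ++ [ d ]) ++ [ b ]) ∸ 1) ≡ d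
at-penultimate a m d b
  rewrite length-∷ʳ (m ++ [ d ]) b | length-∷ʳ m d | ++-assoc m [ d ] [ b ] = at-++-∷ (a ∷ m) d [ b ]

unique-reverse : ∀ {w : Word} → Unique w → Unique (reverse w)
unique-reverse {w} = Unique-resp-↭ (↭⇒↭ₛ (↭-sym (↭-reverse w)))

unique-∷ : ∀ {a} {w : Word} → a ∉ w → Unique w → Unique (a ∷ w)
unique-∷ {w = w} a∉w u = ¬Any⇒All¬ w a∉w ∷ u

unique-++⁻ˡ : ∀ (xs : Word) {ys} → Unique (xs ++ ys) → Unique xs
unique-++⁻ˡ []       u          = []
unique-++⁻ˡ (x ∷ xs) (x∉ ∷ u) = proj₁ (++⁻ xs x∉) ∷ unique-++⁻ˡ xs u

unique-++⁻ʳ : ∀ (xs : Word) {ys} → Unique (xs ++ ys) → Unique ys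
unique-++⁻ʳ []       u       = u
unique-++⁻ʳ (x ∷ xs) (_ ∷ u) = unique-++⁻ʳ xs u

∉-init : ∀ (m : Word) {b} → Unique (m ∷ʳ b) → b ∉ m
∉-init (x ∷ m) (x∉ ∷ _) (here b≡x) with ++⁻ʳ m x∉
... | x≢b ∷ [] = x≢b (sym b≡x)
∉-init (x ∷ m) (_ ∷ u)  (there b∈m) = ∉-init m u b∈m

unique-framed : ∀ {a b} {m : Word} → (∀ k → k ∈ m → k < b) → b < a → Unique m → Unique (a ∷ m ++ [ b ])
unique-framed {a} {b} {m} m<b b<a u = unique-∷ a∉ (Unique.++⁺ u ([] ∷ []) disjoint)
  where
  a∉ : a ∉ m ++ [ b ]
  a∉ a∈ with ∈-++⁻ m a∈
  ... | inj₁ a∈m        = <-asym (m<b a a∈m) b<a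
  ... | inj₂ (here refl) = <-irrefl refl b<a
  disjoint : ∀ {k} → ¬ (k ∈ m × k ∈ [ b ])
  disjoint (k∈m , here refl) = <-irrefl refl (m<b _ k∈m)

subword-∷ : ∀ {t w : Word} a → Subword t w → Subword t (a ∷ w)
subword-∷ a (as , bs , eq) = a ∷ as , bs , cong (a ∷_) eq

subword-++ʳ : ∀ {t w : Word} ys → Subword t w → Subword t (w ++ ys)
subword-++ʳ {t} ys (as , bs , refl) = as , bs ++ ys , (begin
  as ++ t ++ bs ++ ys    ≡⟨ cong (as ++_) (sym (++-assoc t bs ys)) ⟩
  as ++ (t ++ bs) ++ ys  ≡⟨ sym (++-assoc as (t ++ bs) ys) ⟩
  (as ++ t ++ bs) ++ ys  ∎)
  where open ≡-Reasoning

subword-reverse : ∀ {t w : Word} → Subword t w → Subword (reverse t) (reverse w)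
subword-reverse {t} (as , bs , refl) = reverse bs , reverse as , (begin
  reverse bs ++ reverse t ++ reverse as    ≡⟨ sym (++-assoc (reverse bs) (reverse t) (reverse as)) ⟩
  (reverse bs ++ reverse t) ++ reverse as  ≡⟨ cong (_++ reverse as) (sym (reverse-++ t bs)) ⟩
  reverse (t ++ bs) ++ reverse as          ≡⟨ sym (reverse-++ as (t ++ bs)) ⟩
  reverse (as ++ t ++ bs)                  ∎)
  where open ≡-Reasoning

subword-length : ∀ {t w : Word} → Subword t w → length t ≤ length w
subword-length {t} (as , bs , refl) = begin
  length t                            ≤⟨ m≤m+n (length t) (length bs) ⟩
  length t + length bs                ≤⟨ m≤n+m _ (length as) ⟩
  length as + (length t + length bs)  ≡⟨ sym (cong (length as +_) (length-++ t)) ⟩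
  length as + length (t ++ bs)        ≡⟨ sym (length-++ as) ⟩
  length (as ++ t ++ bs)              ∎
  where open ≤-Reasoning

unique-subword : ∀ {t w : Word} → Subword t w → Unique w → Unique t
unique-subword {t} (as , bs , refl) u = unique-++⁻ˡ t (unique-++⁻ʳ as u)

unique-inner : ∀ {a b} {m : Word} → Unique (a ∷ m ++ [ b ]) → Unique m
unique-inner {a} {b} = unique-subword ([ a ] , [ b ] , refl)

∈-subword : ∀ {k} {t w : Word} → Subword t w → k ∈ t → k ∈ w
∈-subword {t = t} (as , bs , refl) k∈ = ∈-++⁺ʳ as (∈-++⁺ˡ k∈)

proper-if-shorter : ∀ {t w : Word} → Subword t w → length t < length w → ProperSubword t w
proper-if-shorter sub t<w = sub , λ { refl → <-irrefl refl t<w }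

prefix⇒subword : ∀ {p w : Word} → Prefix p w → Subword p w
prefix⇒subword (r , eq) = [] , r , eq

suffix⇒subword : ∀ {s w : Word} → Suffix s w → Subword s w
suffix⇒subword {s} (r , eq) = r , [] , trans (cong (r ++_) (++-identityʳ s)) eq

suffix-reverse : ∀ {s w : Word} → Suffix s (reverse w) → Prefix (reverse s) w
suffix-reverse {s} {w} (r , eq) = reverse r , (begin
  reverse s ++ reverse r  ≡⟨ sym (reverse-++ r s) ⟩
  reverse (r ++ s)        ≡⟨ cong reverse eq ⟩
  reverse (reverse w)     ≡⟨ reverse-involutive w ⟩
  w                       ∎)
  where open ≡-Reasoning

suffix-∷ʳ : ∀ {s w : Word} c → Suffix s w → Suffix (s ∷ʳ c) (w ∷ʳ c)
suffix-∷ʳ {s} c (r , refl) = r , sym (++-assoc r s [ c ])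

prefix-reverse : ∀ {p w : Word} → Prefix p (reverse w) → Suffix (reverse p) w
prefix-reverse {p} {w} (r , eq) = reverse r , (begin
  reverse r ++ reverse p  ≡⟨ sym (reverse-++ p r) ⟩
  reverse (p ++ r)        ≡⟨ cong reverse eq ⟩
  reverse (reverse w)     ≡⟨ reverse-involutive w ⟩
  w                       ∎)
  where open ≡-Reasoning

subword-∷⁻ : ∀ {s w : Word} a → Subword s (a ∷ w) → Subword s w ⊎ Σ Word λ s′ → s ≡ a ∷ s′ × Prefix s′ w
subword-∷⁻ {[]}    {w} a ([] , _ , _)    = inj₁ ([] , w , refl)
subword-∷⁻ {x ∷ s}     a ([] , bs , eq) with ∷-injective eq
... | refl , eq′ = inj₂ (s , refl , bs , eq′)
subword-∷⁻             a (_ ∷ as , bs , eq) = inj₁ (as , bs , ∷-injectiveʳ eq)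

prefix-around : ∀ {s} (xs : Word) c ys → Prefix s (xs ++ c ∷ ys) →
  Prefix s xs ⊎ Σ Word λ s₂ → s ≡ xs ++ c ∷ s₂ × Prefix s₂ ys
prefix-around {[]}    xs       c ys _        = inj₁ (xs , refl)
prefix-around {x ∷ s} []       c ys (r , eq) with ∷-injective eq
... | refl , eq′ = inj₂ (s , refl , r , eq′)
prefix-around {x ∷ s} (_ ∷ xs) c ys (r , eq) with ∷-injective eq
... | refl , eq′ with prefix-around xs c ys (r , eq′)
...   | inj₁ (r′ , eq″)        = inj₁ (r′ , cong (x ∷_) eq″)
...   | inj₂ (s₂ , refl , pre) = inj₂ (s₂ , refl , pre)

Straddles : ℕ → Word → Word → Word → Set
Straddles c xs ys s = Σ Word λ s₁ → Σ Word λ s₂ → s ≡ s₁ ++ c ∷ s₂ × Suffix s₁ xs × Prefix s₂ ys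

subword-around : ∀ {s : Word} (xs : Word) c ys → Subword s (xs ++ c ∷ ys) →
  Subword s xs ⊎ Subword s ys ⊎ Straddles c xs ys s
subword-around []       c ys sub with subword-∷⁻ c sub
... | inj₁ s⊑ys               = inj₂ (inj₁ s⊑ys)
... | inj₂ (s₂ , refl , pre) = inj₂ (inj₂ ([] , s₂ , refl , ([] , refl) , pre))
subword-around {s} (x ∷ xs) c ys sub with subword-∷⁻ x sub
... | inj₁ sub′ = extend (subword-around xs c ys sub′)
  where
  extend : Subword s xs ⊎ Subword s ys ⊎ Straddles c xs ys s → Subword s (x ∷ xs) ⊎ Subword s ys ⊎ Straddles c (x ∷ xs) ys s
  extend (inj₁ s⊑xs)                                   = inj₁ (subword-∷ x s⊑xs)
  extend (inj₂ (inj₁ s⊑ys))                            = inj₂ (inj₁ s⊑ys)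
  extend (inj₂ (inj₂ (s₁ , s₂ , eq , (r , eq₁) , pre))) = inj₂ (inj₂ (s₁ , s₂ , eq , (x ∷ r , cong (x ∷_) eq₁) , pre))
... | inj₂ (s′ , refl , pre) with prefix-around xs c ys pre
...   | inj₁ (r , eq)           = inj₁ ([] , r , cong (x ∷_) eq)
...   | inj₂ (s₂ , refl , pre₂) = inj₂ (inj₂ (x ∷ xs , s₂ , refl , ([] , refl) , pre₂))

proper-subword-framed : ∀ {t a b} (m : Word) → ProperSubword t (a ∷ m ++ [ b ]) →
  Subword t (a ∷ m) ⊎ Subword t (m ++ [ b ])
proper-subword-framed m ((_ ∷ as , bs , eq) , _) = inj₂ (as , bs , ∷-injectiveʳ eq)
proper-subword-framed {t} {a} m (([] , bs , eq) , t≢w) with initLast bs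
... | []          = ⊥-elim (t≢w (trans (sym (++-identityʳ t)) eq))
... | bs′ ∷ʳ′ b′ = inj₁ ([] , bs′ , proj₁ (∷ʳ-injective (t ++ bs′) (a ∷ m) (trans (++-assoc t bs′ [ b′ ]) eq)))

cond1-framed⁻ : ∀ a (m : Word) b → Cond1 (a ∷ m ++ [ b ]) → b < a × (∀ k → k ∈ m → k < b)
cond1-framed⁻ a m b (u@(_ ∷ u′) , _ , (_ , ≤a) , (_ , last≢a , ≤last)) = b<a , m<b
  where
  last≡b : at (a ∷ m ++ [ b ]) (length (a ∷ m ++ [ b ])) ≡ b
  last≡b = at-last a m b
  b<a : b < a
  b<a = ≤∧≢⇒< (≤a b (there (∈-++⁺ʳ m (here refl)))) (subst (_≢ a) last≡b last≢a)
  m<b : ∀ k → k ∈ m → k < b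
  m<b k k∈m = ≤∧≢⇒< (subst (k ≤_) last≡b (≤last k (there (∈-++⁺ˡ k∈m)) k≢a)) k≢b
    where
    k≢a : k ≢ a
    k≢a refl = Unique.Unique[x∷xs]⇒x∉xs u (∈-++⁺ˡ k∈m)
    k≢b : k ≢ b
    k≢b refl = ∉-init m u′ k∈m

cond1-framed⁺ : ∀ a (m : Word) b → Unique (a ∷ m ++ [ b ]) → b < a → (∀ k → k ∈ m → k < b) → Cond1 (a ∷ m ++ [ b ])
cond1-framed⁺ a m b u b<a m<b =
  u , length≥2 , (here refl , ≤a) , (subst (_∈ w) (sym last≡b) b∈ , subst (_≢ a) (sym last≡b) b≢a , ≤last)
  where
  w : Word
  w = a ∷ m ++ [ b ]
  last≡b : at w (length w) ≡ b
  last≡b = at-last a m b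
  length≥2 : 2 ≤ length w
  length≥2 rewrite length-framed a m b = s≤s (s≤s z≤n)
  b∈ : b ∈ w
  b∈ = there (∈-++⁺ʳ m (here refl))
  b≢a : b ≢ a
  b≢a b≡a = <-irrefl b≡a b<a
  ≤a : ∀ k → k ∈ w → k ≤ a
  ≤a k k∈ with ∈-framed m k∈
  ... | inj₁ refl        = ≤-refl
  ... | inj₂ (inj₁ k∈m)  = <⇒≤ (<-trans (m<b k k∈m) b<a)
  ... | inj₂ (inj₂ refl) = <⇒≤ b<a
  ≤last : ∀ k → k ∈ w → k ≢ a → k ≤ at w (length w)
  ≤last k k∈ k≢a rewrite last≡b with ∈-framed m k∈
  ... | inj₁ k≡a         = ⊥-elim (k≢a k≡a)
  ... | inj₂ (inj₁ k∈m)  = <⇒≤ (m<b k k∈m)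
  ... | inj₂ (inj₂ refl) = ≤-refl

-- G-words are the case _⊲_ = _>_, R-words the case _⊲_ = _<_.
module Words (_⊲_ : ℕ → ℕ → Set) where

  Cond2 : Word → Set
  Cond2 w = 4 ≤ length w → at w 2 ⊲ at w (length w ∸ 1)

  IsWord : Word → Set
  IsWord w = Cond1 w × Cond2 w

  IsPrimitive : Word → Set
  IsPrimitive w = IsWord w × (∀ x → ProperSubword x w → 4 ≤ length x → ¬ IsWord x × ¬ IsWord (reverse x))

  IsWordUpToReversal : Word → Set
  IsWordUpToReversal t = IsWord t ⊎ IsWord (reverse t)

  Harmless : Word → Set
  Harmless t = 4 ≤ length t → ¬ IsWordUpToReversal t

  -- Condition (G2)/(R2) stated on the interior m = w₂ ⋯ w₍ₙ₋₁₎; vacuous when m has fewer than two letters.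
  EndsRelated : Word → Set
  EndsRelated m = ∀ p k d → m ≡ p ∷ k ++ [ d ] → p ⊲ d

  endsRelated-intro : ∀ {p d} (k : Word) → p ⊲ d → EndsRelated (p ∷ k ++ [ d ])
  endsRelated-intro k p⊲d p′ k′ d′ eq with ∷-injective eq
  ... | refl , eq′ with ∷ʳ-injective k k′ eq′
  ...   | _ , refl = p⊲d

  endsRelated-bridge : ∀ {p d} (U V : Word) c → p ⊲ d → EndsRelated (reverse (U ++ [ p ]) ++ c ∷ V ++ [ d ])
  endsRelated-bridge {p} {d} U V c p⊲d = subst EndsRelated (sym bridge) (endsRelated-intro (reverse U ++ c ∷ V) p⊲d)
    where
    bridge : reverse (U ++ [ p ]) ++ c ∷ V ++ [ d ] ≡ p ∷ (reverse U ++ c ∷ V) ++ [ d ]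
    bridge = begin
      reverse (U ++ [ p ]) ++ c ∷ V ++ [ d ]  ≡⟨ cong (_++ c ∷ V ++ [ d ]) (reverse-++ U [ p ]) ⟩
      p ∷ reverse U ++ c ∷ V ++ [ d ]         ≡⟨ cong (p ∷_) (sym (++-assoc (reverse U) (c ∷ V) [ d ])) ⟩
      p ∷ (reverse U ++ c ∷ V) ++ [ d ]       ∎
      where open ≡-Reasoning

  endsRelated-reverse : Asymmetric _⊲_ → ∀ (m : Word) → 2 ≤ length m → EndsRelated m → ¬ EndsRelated (reverse m)
  endsRelated-reverse ⊲-asym (p ∷ m′) _ ends ends* with initLast m′
  endsRelated-reverse ⊲-asym (p ∷ m′) (s≤s ()) ends ends* | []
  ... | k ∷ʳ′ d = ⊲-asym (ends p k d refl) (ends* d (reverse k) p (reverse-framed p k d))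

  cond2-framed⁻ : ∀ a (m : Word) b → Cond2 (a ∷ m ++ [ b ]) → EndsRelated m
  cond2-framed⁻ a m b second⊲penultimate p k d refl =
    subst (p ⊲_) (at-penultimate a (p ∷ k) d b) (second⊲penultimate length≥4)
    where
    length≥4 : 4 ≤ length (a ∷ (p ∷ k ++ [ d ]) ++ [ b ])
    length≥4 rewrite length-framed a (p ∷ k ++ [ d ]) b | length-∷ʳ k d = s≤s (s≤s (s≤s (s≤s z≤n)))

  cond2-framed⁺ : ∀ a (m : Word) b → EndsRelated m → Cond2 (a ∷ m ++ [ b ])
  cond2-framed⁺ a []       b ends (s≤s (s≤s ()))
  cond2-framed⁺ a (p ∷ m′) b ends length≥4 with initLast m′
  cond2-framed⁺ a (p ∷ m′) b ends (s≤s (s≤s (s≤s ()))) | []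
  ... | k ∷ʳ′ d = subst (p ⊲_) (sym (at-penultimate a (p ∷ k) d b)) (ends p k d refl)

  record WordShape (a : ℕ) (m : Word) (b : ℕ) : Set where
    field
      last<first : b < a
      inner<last : ∀ k → k ∈ m → k < b
      endsRelated : EndsRelated m

  isWord⇒shape : ∀ a (m : Word) b → IsWord (a ∷ m ++ [ b ]) → WordShape a m b
  isWord⇒shape a m b (cond1 , cond2) = record
    { last<first  = proj₁ (cond1-framed⁻ a m b cond1)
    ; inner<last  = proj₂ (cond1-framed⁻ a m b cond1)
    ; endsRelated = cond2-framed⁻ a m b cond2
    }

  shape⇒isWord : ∀ a (m : Word) b → Unique (a ∷ m ++ [ b ]) → WordShape a m b → IsWord (a ∷ m ++ [ b ])
  shape⇒isWord a m b u shape =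
    cond1-framed⁺ a m b u last<first inner<last , cond2-framed⁺ a m b endsRelated
    where open WordShape shape

  upToReversal-reverse : ∀ (t : Word) → IsWordUpToReversal t → IsWordUpToReversal (reverse t)
  upToReversal-reverse t (inj₁ word)  = inj₂ (subst IsWord (sym (reverse-involutive t)) word)
  upToReversal-reverse t (inj₂ word*) = inj₁ word*

  harmless-reverse⁻ : ∀ (t : Word) → Harmless (reverse t) → Harmless t
  harmless-reverse⁻ t harmless* length≥4 bad =
    harmless* (subst (4 ≤_) (sym (length-reverse t)) length≥4) (upToReversal-reverse t bad)

  upToReversal-shape : ∀ a (m : Word) b → IsWordUpToReversal (a ∷ m ++ [ b ]) →
    WordShape a m b ⊎ WordShape b (reverse m) a
  upToReversal-shape a m b (inj₁ word)  = inj₁ (isWord⇒shape a m b word)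
  upToReversal-shape a m b (inj₂ word*) = inj₂ (isWord⇒shape b (reverse m) a (subst IsWord (reverse-framed a m b) word*))

  upToReversal⇒inner<ends : ∀ {a b k} (m : Word) → IsWordUpToReversal (a ∷ m ++ [ b ]) → k ∈ m → k < a × k < b
  upToReversal⇒inner<ends {a} {b} {k} m bad k∈m with upToReversal-shape a m b bad
  ... | inj₁ shape = <-trans k<b (WordShape.last<first shape) , k<b
    where k<b = WordShape.inner<last shape k k∈m
  ... | inj₂ shape = k<a , <-trans k<a (WordShape.last<first shape)
    where k<a = WordShape.inner<last shape k (Any.reverse⁺ k∈m)

  upToReversal⇒shape : ∀ {a b} (m : Word) → IsWordUpToReversal (a ∷ m ++ [ b ]) → b < a → WordShape a m b
  upToReversal⇒shape {a} {b} m bad b<a with upToReversal-shape a m b bad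
  ... | inj₁ shape = shape
  ... | inj₂ shape = ⊥-elim (<-asym b<a (WordShape.last<first shape))

  upToReversal-replaceFirst : ∀ {a a′ b} (m : Word) → IsWordUpToReversal (a ∷ m ++ [ b ]) → b < a → b < a′ →
    Unique (a′ ∷ m ++ [ b ]) → IsWord (a′ ∷ m ++ [ b ])
  upToReversal-replaceFirst {a′ = a′} {b} m bad b<a b<a′ u = shape⇒isWord a′ m b u
    (record { last<first = b<a′ ; inner<last = inner<last ; endsRelated = endsRelated })
    where open WordShape (upToReversal⇒shape m bad b<a)

  upToReversal-replaceLast : ∀ {a b b′} (m : Word) → IsWordUpToReversal (a ∷ m ++ [ b ]) → a < b → a < b′ →
    Unique (a ∷ m ++ [ b′ ]) → IsWordUpToReversal (a ∷ m ++ [ b′ ])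
  upToReversal-replaceLast {a} {b} {b′} m bad a<b a<b′ u =
    inj₂ (subst IsWord (sym (reverse-framed a m b′)) (upToReversal-replaceFirst (reverse m) bad* a<b a<b′ u*))
    where
    bad* : IsWordUpToReversal (b ∷ reverse m ++ [ a ])
    bad* = subst IsWordUpToReversal (reverse-framed a m b) (upToReversal-reverse _ bad)
    u* : Unique (b′ ∷ reverse m ++ [ a ])
    u* = subst Unique (reverse-framed a m b′) (unique-reverse u)

  ¬upToReversal-straddle : ∀ {c e f} (xs m : Word) → f < c → ¬ IsWordUpToReversal (e ∷ xs ++ c ∷ m ++ [ f ])
  ¬upToReversal-straddle {c} {e} {f} xs m f<c bad =
    <-asym f<c (proj₂ (upToReversal⇒inner<ends (xs ++ c ∷ m) bad′ (∈-++⁺ʳ xs (here refl))))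
    where
    bad′ : IsWordUpToReversal (e ∷ (xs ++ c ∷ m) ++ [ f ])
    bad′ = subst IsWordUpToReversal (cong (e ∷_) (sym (++-assoc xs (c ∷ m) [ f ]))) bad

  primitive⇒unique : ∀ {w : Word} → IsPrimitive w → Unique w
  primitive⇒unique ((cond1 , _) , _) = proj₁ cond1

  primitive⇒shape : ∀ {a b} (m : Word) → IsPrimitive (a ∷ m ++ [ b ]) → WordShape a m b
  primitive⇒shape {a} {b} m (word , _) = isWord⇒shape a m b word

  primitive⇒inner<last : ∀ {a b} (m : Word) → IsPrimitive (a ∷ m ++ [ b ]) → ∀ k → k ∈ m → k < b
  primitive⇒inner<last m prim = WordShape.inner<last (primitive⇒shape m prim)

  primitive⇒harmless : ∀ {w t : Word} → IsPrimitive w → ProperSubword t w → Harmless t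
  primitive⇒harmless (_ , free) proper length≥4 (inj₁ word)  = proj₁ (free _ proper length≥4) word
  primitive⇒harmless (_ , free) proper length≥4 (inj₂ word*) = proj₂ (free _ proper length≥4) word*

  primitive⇒harmless-init : ∀ {a b} {m t : Word} → IsPrimitive (a ∷ m ++ [ b ]) → Subword t (a ∷ m) → Harmless t
  primitive⇒harmless-init {a} {b} {m} {t} prim sub =
    primitive⇒harmless prim (proper-if-shorter (subword-++ʳ [ b ] sub) shorter)
    where
    shorter : length t < length (a ∷ m ++ [ b ])
    shorter rewrite length-framed a m b = s≤s (subword-length sub)

  primitive⇒harmless-tail : ∀ {a b} {m t : Word} → IsPrimitive (a ∷ m ++ [ b ]) → Subword t (m ++ [ b ]) → Harmless t
  primitive⇒harmless-tail {a} prim sub = primitive⇒harmless prim (proper-if-shorter (subword-∷ a sub) (s≤s (subword-length sub)))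

  primitive-¬last∷prefix : ∀ {a c} {W s : Word} → IsPrimitive (a ∷ W ++ [ c ]) → Prefix s W → Harmless (c ∷ s)
  primitive-¬last∷prefix {s = s} prim pre length≥4 bad with initLast s
  primitive-¬last∷prefix prim pre (s≤s ()) bad | []
  primitive-¬last∷prefix {a} {c} prim (r , refl) length≥4 bad | m ∷ʳ′ f =
    primitive⇒harmless-init prim prefix length≥4 (inj₁ word)
    where
    open WordShape (primitive⇒shape ((m ++ [ f ]) ++ r) prim)
    f<c : f < c
    f<c = inner<last f (∈-++⁺ˡ (∈-++⁺ʳ m (here refl)))
    prefix : Subword (a ∷ m ++ [ f ]) (a ∷ (m ++ [ f ]) ++ r)
    prefix = [] , r , refl
    word : IsWord (a ∷ m ++ [ f ])
    word = upToReversal-replaceFirst m bad f<c (<-trans f<c last<first)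
      (unique-subword (subword-++ʳ [ c ] prefix) (primitive⇒unique prim))

  primitive-¬suffix∷ʳlarger : ∀ {a c h} {W s : Word} → IsPrimitive (a ∷ W ++ [ c ]) → c < h → Suffix s W → Harmless (s ∷ʳ h)
  primitive-¬suffix∷ʳlarger {s = []} prim c<h suf (s≤s ()) bad
  primitive-¬suffix∷ʳlarger {a} {c} {h} {s = e ∷ m} prim c<h (r , refl) length≥4 bad =
    primitive⇒harmless-tail prim suffix (subst (4 ≤_) (trans (length-framed e m h) (sym (length-framed e m c))) length≥4) bad′
    where
    e<c : e < c
    e<c = primitive⇒inner<last (r ++ e ∷ m) prim e (∈-++⁺ʳ r (here refl))
    suffix : Subword (e ∷ m ++ [ c ]) ((r ++ e ∷ m) ++ [ c ])
    suffix = suffix⇒subword (suffix-∷ʳ c (r , refl))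
    bad′ : IsWordUpToReversal (e ∷ m ++ [ c ])
    bad′ = upToReversal-replaceLast m bad (<-trans e<c c<h) e<c
      (unique-subword (subword-∷ a suffix) (primitive⇒unique prim))

  module Gluing (⊲-asym : Asymmetric _⊲_) {c u₁ v₁ : ℕ} {U V : Word}
    (u-prim : IsPrimitive (u₁ ∷ U ++ [ c ])) (v-prim : IsPrimitive (v₁ ∷ V ++ [ c ])) where

    prefix-last<c : ∀ {m : Word} {f} → Prefix (m ∷ʳ f) V → f < c
    prefix-last<c {m} pre = primitive⇒inner<last V v-prim _ (∈-subword (prefix⇒subword pre) (∈-++⁺ʳ m (here refl)))

    harmless-inside : ∀ {s : Word} → Subword s (reverse U ++ c ∷ V) → Harmless s
    harmless-inside {s} sub with subword-around (reverse U) c V sub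
    ... | inj₁ s⊑U* = harmless-reverse⁻ s (primitive⇒harmless-tail u-prim
            (subword-++ʳ [ c ] (subst (Subword (reverse s)) (reverse-involutive U) (subword-reverse s⊑U*))))
    ... | inj₂ (inj₁ s⊑V) = primitive⇒harmless-tail v-prim (subword-++ʳ [ c ] s⊑V)
    ... | inj₂ (inj₂ ([] , s₂ , refl , _ , pre)) = primitive-¬last∷prefix v-prim pre
    ... | inj₂ (inj₂ (e ∷ s₁ , s₂ , refl , suf , pre)) with initLast s₂
    ...   | [] = harmless-reverse⁻ s (subst Harmless (sym (reverse-++ (e ∷ s₁) [ c ]))
                   (primitive-¬last∷prefix u-prim (suffix-reverse suf)))
    ...   | m ∷ʳ′ f = λ _ → ¬upToReversal-straddle s₁ m (prefix-last<c pre)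

    harmless-from-top : ∀ {h} {s : Word} → c < h → Prefix s (reverse U ++ c ∷ V) → Harmless (h ∷ s)
    harmless-from-top {h} {s} c<h pre with prefix-around (reverse U) c V pre
    ... | inj₁ pre′ = harmless-reverse⁻ (h ∷ s) (subst Harmless (sym (unfold-reverse h s))
                        (primitive-¬suffix∷ʳlarger u-prim c<h (prefix-reverse pre′)))
    ... | inj₂ (s₂ , refl , pre₂) with initLast s₂
    ...   | m ∷ʳ′ f = λ _ → ¬upToReversal-straddle (reverse U) m (prefix-last<c pre₂)
    ...   | [] = λ length≥4 bad → endsRelated-reverse ⊲-asym U (length-U≥2 length≥4)
                   (WordShape.endsRelated (primitive⇒shape U u-prim))
                   (WordShape.endsRelated (upToReversal⇒shape (reverse U) bad c<h))
      where
      length-U≥2 : 4 ≤ length (h ∷ reverse U ++ [ c ]) → 2 ≤ length U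
      length-U≥2 length≥4 rewrite length-framed h (reverse U) c | length-reverse U = ≤-pred (≤-pred length≥4)

    harmless-below-top : ∀ {h} {s : Word} → c < h → Subword s (h ∷ reverse U ++ c ∷ V) → Harmless s
    harmless-below-top {h} c<h sub with subword-∷⁻ h sub
    ... | inj₁ sub′              = harmless-inside sub′
    ... | inj₂ (s′ , refl , pre) = harmless-from-top c<h pre

  glued-primitive : Asymmetric _⊲_ → ∀ {n N₁ c u₁ v₁} {U V : Word} →
    IsPrimitive (u₁ ∷ U ++ [ c ]) → IsPrimitive (v₁ ∷ V ++ [ c ]) → c < N₁ → N₁ < n →
    (∀ k → k ∈ U → k ∈ V → k ≡ c) → EndsRelated (reverse U ++ c ∷ V) →
    IsPrimitive (n ∷ reverse U ++ c ∷ V ++ [ N₁ ])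
  -- A proper subword misses n or N₁; in the latter case its reversal lies in the mirror-image gluing
  -- N₁ ∷ reverse V ++ c ∷ U, which harmless-below-top covers with the roles of u and v exchanged.
  glued-primitive ⊲-asym {n} {N₁} {c} {u₁} {v₁} {U} {V} u-prim v-prim c<N₁ N₁<n U∩V⊆c ends = word , proper-harmless
    where
    M : Word
    M = reverse U ++ c ∷ V
    framing : n ∷ M ++ [ N₁ ] ≡ n ∷ reverse U ++ c ∷ V ++ [ N₁ ]
    framing = cong (n ∷_) (++-assoc (reverse U) (c ∷ V) [ N₁ ])
    U<c : ∀ k → k ∈ U → k < c
    U<c = primitive⇒inner<last U u-prim
    V<c : ∀ k → k ∈ V → k < c
    V<c = primitive⇒inner<last V v-prim
    M<N₁ : ∀ k → k ∈ M → k < N₁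
    M<N₁ k k∈ with ∈-++⁻ (reverse U) k∈
    ... | inj₁ k∈U*         = <-trans (U<c k (Any.reverse⁻ k∈U*)) c<N₁
    ... | inj₂ (here refl)  = c<N₁
    ... | inj₂ (there k∈V)  = <-trans (V<c k k∈V) c<N₁
    unique-M : Unique M
    unique-M = Unique.++⁺ (unique-reverse (unique-inner (primitive⇒unique u-prim)))
                          (unique-∷ (λ c∈V → <-irrefl refl (V<c c c∈V)) (unique-inner (primitive⇒unique v-prim)))
                          disjoint
      where
      disjoint : ∀ {k} → ¬ (k ∈ reverse U × k ∈ c ∷ V)
      disjoint (k∈U* , here refl)  = <-irrefl refl (U<c _ (Any.reverse⁻ k∈U*))
      disjoint (k∈U* , there k∈V) = <-irrefl (U∩V⊆c _ k∈U k∈V) (U<c _ k∈U)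
        where k∈U = Any.reverse⁻ k∈U*
    word : IsWord (n ∷ reverse U ++ c ∷ V ++ [ N₁ ])
    word = subst IsWord framing (shape⇒isWord n M N₁ (unique-framed M<N₁ N₁<n unique-M)
      (record { last<first = N₁<n ; inner<last = M<N₁ ; endsRelated = ends }))
    reversal : reverse (M ++ [ N₁ ]) ≡ N₁ ∷ reverse V ++ c ∷ U
    reversal = begin
      reverse (M ++ [ N₁ ])                    ≡⟨ reverse-++ M [ N₁ ] ⟩
      N₁ ∷ reverse M                           ≡⟨ cong (N₁ ∷_) (reverse-around (reverse U) c V) ⟩
      N₁ ∷ reverse V ++ c ∷ reverse (reverse U) ≡⟨ cong (λ z → N₁ ∷ reverse V ++ c ∷ z) (reverse-involutive U) ⟩
      N₁ ∷ reverse V ++ c ∷ U                  ∎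
      where open ≡-Reasoning
    proper-harmless : ∀ t → ProperSubword t (n ∷ reverse U ++ c ∷ V ++ [ N₁ ]) → 4 ≤ length t →
      ¬ IsWord t × ¬ IsWord (reverse t)
    proper-harmless t proper length≥4 = (λ w → harmless (inj₁ w)) , (λ w → harmless (inj₂ w))
      where
      harmless : ¬ IsWordUpToReversal t
      harmless with proper-subword-framed M (subst (ProperSubword t) (sym framing) proper)
      ... | inj₁ sub = Gluing.harmless-below-top ⊲-asym u-prim v-prim (<-trans c<N₁ N₁<n) sub length≥4
      ... | inj₂ sub = harmless-reverse⁻ t (Gluing.harmless-below-top ⊲-asym v-prim u-prim c<N₁
                         (subst (Subword (reverse t)) reversal (subword-reverse sub))) length≥4

  gluing-primitive : Asymmetric _⊲_ → ∀ {c x₁ y₁ p d} (X Y : Word) →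
    (∀ k → k ∈ x₁ ∷ (X ++ [ p ]) ++ [ c ] → k ∈ y₁ ∷ (Y ++ [ d ]) ++ [ c ] → k ≡ c) → p ⊲ d →
    IsPrimitive (x₁ ∷ (X ++ [ p ]) ++ [ c ]) → IsPrimitive (y₁ ∷ (Y ++ [ d ]) ++ [ c ]) →
    IsPrimitive (suc (suc c) ∷ reverse (inner (x₁ ∷ (X ++ [ p ]) ++ [ c ])) ++ c ∷ inner (y₁ ∷ (Y ++ [ d ]) ++ [ c ]) ++ [ suc c ])
  gluing-primitive ⊲-asym {c} {x₁} {y₁} {p} {d} X Y x∩y⊆c p⊲d x-prim y-prim =
    subst IsPrimitive (sym inners)
      (glued-primitive ⊲-asym x-prim y-prim (n<1+n c) (n<1+n (suc c)) X∩Y⊆c (endsRelated-bridge X Y c p⊲d))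
    where
    inners : suc (suc c) ∷ reverse (inner (x₁ ∷ (X ++ [ p ]) ++ [ c ])) ++ c ∷ inner (y₁ ∷ (Y ++ [ d ]) ++ [ c ]) ++ [ suc c ]
           ≡ suc (suc c) ∷ reverse (X ++ [ p ]) ++ c ∷ (Y ++ [ d ]) ++ [ suc c ]
    inners = cong₂ (λ U V → suc (suc c) ∷ reverse U ++ c ∷ V ++ [ suc c ]) (inner-framed x₁ (X ++ [ p ]) c) (inner-framed y₁ (Y ++ [ d ]) c)
    X∩Y⊆c : ∀ k → k ∈ X ++ [ p ] → k ∈ Y ++ [ d ] → k ≡ c
    X∩Y⊆c k k∈X k∈Y = x∩y⊆c k (there (∈-++⁺ˡ k∈X)) (there (∈-++⁺ˡ k∈Y))

data NonemptyInterior : Word → Set where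
  interior : ∀ a (m : Word) d b → NonemptyInterior (a ∷ (m ++ [ d ]) ++ [ b ])

nonemptyInterior : ∀ (w : Word) → 3 ≤ length w → NonemptyInterior w
nonemptyInterior (a ∷ w′) length≥3 with initLast w′
nonemptyInterior (a ∷ w′) (s≤s ()) | []
... | m′ ∷ʳ′ b with initLast m′
nonemptyInterior (a ∷ w′) (s≤s (s≤s ())) | m′ ∷ʳ′ b | []
...   | m ∷ʳ′ d = interior a m d b

lemma6 : (n : ℕ) (x y : Word) → 4 ≤ n
    → Unique x → Unique y
    → 3 ≤ length x → 3 ≤ length y
    → (∀ k → k ∈ x → 1 ≤ k × k ≤ n)
    → (∀ k → k ∈ y → 1 ≤ k × k ≤ n)
    → (∀ k → 1 ≤ k → k ≤ n → k ∈ x ⊎ k ∈ y)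
    → (∀ k → k ∈ x → k ∈ y → k ≡ n ∸ 2)
    → (n ∸ 2) ∈ x → (n ∸ 2) ∈ y
    → at x (length x) ≡ n ∸ 2 → at y (length y) ≡ n ∸ 2
    → at x (length x ∸ 1) > at y (length y ∸ 1)
    → (IsPrimitiveG x → IsPrimitiveG y → IsPrimitiveG (wordG n x y))
      × (IsPrimitiveR x → IsPrimitiveR y → IsPrimitiveR (wordR n x y))
lemma6 _ x y (s≤s (s≤s (s≤s (s≤s _)))) _ _ x≥3 y≥3 _ _ _ x∩y _ _ x-end y-end x>y
  with nonemptyInterior x x≥3 | nonemptyInterior y y≥3
... | interior x₁ X p c | interior y₁ Y d c′
  with trans (sym (at-last x₁ (X ++ [ p ]) c)) x-end | trans (sym (at-last y₁ (Y ++ [ d ]) c′)) y-end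
... | refl | refl =
    Words.gluing-primitive _>_ <-asym X Y x∩y p>d
  , flip (Words.gluing-primitive _<_ <-asym Y X (λ k k∈y k∈x → x∩y k k∈x k∈y) p>d)
  where
  p>d : p > d
  p>d = subst₂ _>_ (at-penultimate x₁ X p c) (at-penultimate y₁ Y d c) x>y
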